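{- For any valise $(4,1)$ adinkras $A$ and $A'$ on the same labeled vertex set, $\mathcal{OG}(A,A')=-\frac{1}{24}\big[\operatorname{tr}(g_{12})+\operatorname{tr}(g_{13})+\operatorname{tr}(g_{14})\big]\big(1+\chi_0(A)\chi_0(A')\big)$, where $g_{IJ}=(\phi_{IJ}\phi'_{IJ})|_F$. In particular, if $\chi_0(A)\neq\chi_0(A')$ then $\mathcal{OG}(A,A')=0$.
   Context: Vertices: bosons $B=\{b_1,\dots,b_4\}$, fermions $F=\{f_1,\dots,f_4\}$. A valise $(4,1)$ adinkra is $K_{4,4}$ between $B$ and $F$ with edges colored by $\{1,2,3,4\}$ (each vertex has one edge of each color; any two colors form a disjoint union of $4$-cycles) and an odd dashing (every two-colored $4$-cycle has an odd number of dashed edges). For color $I$, $L_I$ is the $4\times4$ matrix (rows bosons, columns fermions) with $(i,j)$ entry $+1$/$-1$ if $b_i,f_j$ are joined by a solid/dashed edge of color $I$, else $0$; $R_I=L_I^T$; with basis ordered fermions first, $\phi_I=\begin{bmatrix}0&R_I\\L_I&0\end{bmatrix}$ and $\phi_{IJ}=\phi_I\phi_J$ (block diagonal); $(\cdot)|_F$ is the fermionic (upper-left) block. $\phi'_*$ are the analogous matrices for $A'$. The chirality $\chi_0(A)\in\{\pm1\}$ satisfies $\phi_1\phi_2\phi_3\phi_4=\begin{bmatrix}-\chi_0(A)\mathbb{1}_4&0\\0&\chi_0(A)\mathbb{1}_4\end{bmatrix}$. With holoraumy matrices $\widetilde V_{IJ}=-i(\phi_{IJ})|_F$, the gadget is $\mathcal{OG}(A,A')=\frac1{48}\sum_{I\neq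 J}\operatorname{tr}(\widetilde V_{IJ}\widetilde V'_{IJ})=-\frac1{48}\sum_{I\ne J}\operatorname{tr}\big((\phi_{IJ}\phi'_{IJ})|_F\big)$. -}

module Defs where

open import Data.Nat using (ℕ; zero; suc)
open import Data.Fin using (Fin; zero; suc; splitAt; _↑ˡ_)
open import Data.Integer using (ℤ; +_; -_; _+_; _*_; 0ℤ; 1ℤ)
open import Data.Rational using (ℚ) renaming (_/_ to _÷_; _*_ to _*ℚ_; -_ to -ℚ_)
open import Data.Bool using (Bool; true; false; if_then_else_; _xor_)
open import Data.Sum using (_⊎_; inj₁; inj₂)
open import Data.Product using (∃!; _×_)
open import Relation.Binary.PropositionalEquality using (_≡_; _≢_)
open import Relation.Nullary using (yes; no)
open import Data.Fin using (_≟_)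
open import Relation.Nullary.Decidable using (⌊_⌋)

c1 c2 c3 c4 : Fin 4
c1 = zero
c2 = suc zero
c3 = suc (suc zero)
c4 = suc (suc (suc zero))

-- Colors, bosons and fermions are all indexed by Fin 4 (index 0 = label 1, etc.).
-- An edge b_i f_j of K_{4,4} has color (color i j) and is dashed iff (dashed i j).
record Valise41 : Set where
  field
    color  : Fin 4 → Fin 4 → Fin 4
    dashed : Fin 4 → Fin 4 → Bool
    colorB : ∀ (i I : Fin 4) → ∃! _≡_ (λ j → color i j ≡ I)
    colorF : ∀ (j I : Fin 4) → ∃! _≡_ (λ i → color i j ≡ I)
    -- any two colors form a disjoint union of 4-cycles: every alternating
    -- path b_i -I- f_j -J- b_k -I- f_l closes up with a J-edge f_l -J- b_i
    fourCycles : ∀ (I J : Fin 4) → I ≢ J → ∀ (i j k l : Fin 4) →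
      color i j ≡ I → color k j ≡ J → color k l ≡ I → color i l ≡ J
    oddDashing : ∀ (I J : Fin 4) → I ≢ J → ∀ (i j k l : Fin 4) →
      color i j ≡ I → color k j ≡ J → color k l ≡ I → color i l ≡ J →
      (dashed i j xor dashed k j xor dashed k l xor dashed i l) ≡ true

open Valise41 public

Mat : ℕ → ℕ → Set
Mat m n = Fin m → Fin n → ℤ

Σ[_] : ∀ {n} → (Fin n → ℤ) → ℤ
Σ[_] {zero}  f = 0ℤ
Σ[_] {suc n} f = f zero + Σ[ (λ i → f (suc i)) ]

_⊗_ : ∀ {m n p} → Mat m n → Mat n p → Mat m p
(M ⊗ N) a c = Σ[ (λ b → M a b * N b c) ]

tr : ∀ {n} → Mat n n → ℤ
tr M = Σ[ (λ a → M a a) ]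

transpose : ∀ {m n} → Mat m n → Mat n m
transpose M a b = M b a

-- L_I : rows bosons, columns fermions
L : Valise41 → Fin 4 → Mat 4 4
L A I i j with color A i j ≟ I
... | yes _ = if dashed A i j then - 1ℤ else 1ℤ
... | no  _ = 0ℤ

R : Valise41 → Fin 4 → Mat 4 4
R A I = transpose (L A I)

-- phi_I on the 8-dimensional space, fermions (first 4 indices) first:
-- phi_I = [[0, R_I], [L_I, 0]]
φ : Valise41 → Fin 4 → Mat 8 8
φ A I x y with splitAt 4 x | splitAt 4 y
... | inj₁ a | inj₁ b = 0ℤ
... | inj₁ a | inj₂ b = R A I a b
... | inj₂ a | inj₁ b = L A I a b
... | inj₂ a | inj₂ b = 0ℤ

φ₂ : Valise41 → Fin 4 → Fin 4 → Mat 8 8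
φ₂ A I J = φ A I ⊗ φ A J

∣F : Mat 8 8 → Mat 4 4
∣F M a b = M (a ↑ˡ 4) (b ↑ˡ 4)

diagBlock : ℤ → Mat 8 8
diagBlock χ x y with splitAt 4 x | splitAt 4 y
... | inj₁ a | inj₁ b = if ⌊ a ≟ b ⌋ then - χ else 0ℤ
... | inj₂ a | inj₂ b = if ⌊ a ≟ b ⌋ then χ else 0ℤ
... | _ | _ = 0ℤ

IsChirality : Valise41 → ℤ → Set
IsChirality A χ =
  ∀ x y → ((((φ A c1 ⊗ φ A c2) ⊗ φ A c3) ⊗ φ A c4) x y) ≡ diagBlock χ x y

g : Valise41 → Valise41 → Fin 4 → Fin 4 → Mat 4 4
g A A' I J = ∣F (φ₂ A I J ⊗ φ₂ A' I J)

sumOffDiag : Valise41 → Valise41 → ℤ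
sumOffDiag A A' = Σ[ (λ I → Σ[ (λ J → if ⌊ I ≟ J ⌋ then 0ℤ else tr (g A A' I J)) ]) ]

OG : Valise41 → Valise41 → ℚ
OG A A' = -ℚ (sumOffDiag A A' ÷ 48)

module Submission where

-- The fermionic block of φ_I φ_J is R_I L_J, so tr g_IJ = tr (R_I L_J R'_I L'_J).  The colouring and
-- the odd dashing of a valise give the garden algebra L_I R_J + L_J R_I = 2 δ_IJ 𝟙 (and the same with
-- L, R interchanged, by duality).  Hence R_J L_I = -(R_I L_J) = (R_I L_J)⁻¹ for I ≠ J, and the
-- chirality relation R_1L_2 R_3L_4 = -χ 𝟙 can be solved for R_3L_4 = χ R_1L_2, R_2L_4 = -χ R_1L_3 and
-- R_2L_3 = χ R_1L_4; squaring the first also gives χ² = 1.  So tr g_JI = tr g_IJ and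
-- tr g_34 = χχ' tr g_12, tr g_24 = χχ' tr g_13, tr g_23 = χχ' tr g_14, and the twelve off-diagonal
-- traces add up to 2 (tr g_12 + tr g_13 + tr g_14)(1 + χχ'), which vanishes when χχ' = -1.

open import Defs
open import Data.Nat using (ℕ; zero; suc) renaming (_+_ to _+ℕ_)
open import Data.Fin using (Fin; zero; suc; _↑ˡ_; _↑ʳ_; _≟_)
open import Data.Fin.Properties using (suc-injective; splitAt-↑ˡ; splitAt-↑ʳ)
open import Data.Integer using (ℤ; _+_; _*_; _-_; -_; +_; -[1+_]; 0ℤ; 1ℤ; -1ℤ)
import Data.Integer.Properties as ℤ
open import Data.Integer.Tactic.RingSolver using (solve-∀)
open import Data.Rational using (ℚ; 0ℚ; toℚᵘ) renaming (_/_ to _÷_; _*_ to _*ℚ_; -_ to -ℚ_)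
import Data.Rational.Properties as ℚ
open import Data.Rational.Unnormalised using (mkℚᵘ; *≡*) renaming (_*_ to _*ᵘ_; -_ to -ᵘ_)
import Data.Rational.Unnormalised.Properties as ℚᵘ
open import Data.Bool using (Bool; true; false; if_then_else_; _xor_)
open import Data.Bool.Properties using (xor-assoc)
open import Data.Product using (_×_; _,_; proj₁; proj₂)
open import Data.Sum using (_⊎_; inj₁; inj₂)
open import Data.Empty using (⊥-elim)
open import Function using (_∘_)
open import Relation.Nullary using (Dec; yes; no)
open import Relation.Nullary.Decidable using (⌊_⌋)
open import Relation.Binary.Bundles using (Setoid)
open import Relation.Binary.PropositionalEquality
  using (_≡_; _≢_; refl; sym; trans; cong; cong₂; subst; _≗_; ≢-sym; module ≡-Reasoning)
import Relation.Binary.Reasoning.Setoid as SetoidReasoning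
open import Algebra.Properties.Semiring.Sum ℤ.+-*-semiring using (sum; ∑-comm; *-distribˡ-sum; *-distribʳ-sum)
open import Algebra.Properties.CommutativeSemigroup ℤ.*-commutativeSemigroup using (x∙yz≈y∙xz)

Σ-cong : ∀ {n} {f h : Fin n → ℤ} → f ≗ h → Σ[ f ] ≡ Σ[ h ]
Σ-cong {zero}  f≗h = refl
Σ-cong {suc n} f≗h = cong₂ _+_ (f≗h zero) (Σ-cong (λ i → f≗h (suc i)))

Σ≡sum : ∀ {n} (f : Fin n → ℤ) → Σ[ f ] ≡ sum f
Σ≡sum {zero}  f = refl
Σ≡sum {suc n} f = cong (_+_ (f zero)) (Σ≡sum (λ i → f (suc i)))

Σ-comm : ∀ {m n} (f : Fin m → Fin n → ℤ) →
  Σ[ (λ i → Σ[ (λ j → f i j) ]) ] ≡ Σ[ (λ j → Σ[ (λ i → f i j) ]) ]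
Σ-comm f = begin
  Σ[ (λ i → Σ[ (λ j → f i j) ]) ]  ≡⟨ ΣΣ≡sumsum f ⟩
  sum (λ i → sum (λ j → f i j))    ≡⟨ ∑-comm f ⟩
  sum (λ j → sum (λ i → f i j))    ≡⟨ ΣΣ≡sumsum (λ j i → f i j) ⟨
  Σ[ (λ j → Σ[ (λ i → f i j) ]) ]  ∎
  where
  open ≡-Reasoning
  ΣΣ≡sumsum : ∀ {m n} (h : Fin m → Fin n → ℤ) → Σ[ (λ i → Σ[ h i ]) ] ≡ sum (λ i → sum (h i))
  ΣΣ≡sumsum h = trans (Σ-cong (λ i → Σ≡sum (h i))) (Σ≡sum (λ i → sum (h i)))

Σ-*ˡ : ∀ {n} c (f : Fin n → ℤ) → Σ[ (λ i → c * f i) ] ≡ c * Σ[ f ]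
Σ-*ˡ c f = trans (Σ≡sum (λ i → c * f i)) (sym (trans (cong (c *_) (Σ≡sum f)) (*-distribˡ-sum c f)))

Σ-*ʳ : ∀ {n} c (f : Fin n → ℤ) → Σ[ (λ i → f i * c) ] ≡ Σ[ f ] * c
Σ-*ʳ c f = trans (Σ≡sum (λ i → f i * c)) (sym (trans (cong (_* c) (Σ≡sum f)) (*-distribʳ-sum c f)))

Σ-zero : ∀ {n} {f : Fin n → ℤ} → (∀ i → f i ≡ 0ℤ) → Σ[ f ] ≡ 0ℤ
Σ-zero {zero}  f≡0 = refl
Σ-zero {suc n} f≡0 = cong₂ _+_ (f≡0 zero) (Σ-zero (λ i → f≡0 (suc i)))

Σ-single : ∀ {n} (f : Fin n → ℤ) i → (∀ j → j ≢ i → f j ≡ 0ℤ) → Σ[ f ] ≡ f i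
Σ-single {suc n} f zero vanish =
  trans (cong (_+_ (f zero)) (Σ-zero (λ j → vanish (suc j) (λ ())))) (ℤ.+-identityʳ (f zero))
Σ-single {suc n} f (suc i) vanish = begin
  f zero + Σ[ (λ j → f (suc j)) ]  ≡⟨ cong (_+ Σ[ (λ j → f (suc j)) ]) (vanish zero (λ ())) ⟩
  0ℤ + Σ[ (λ j → f (suc j)) ]      ≡⟨ ℤ.+-identityˡ _ ⟩
  Σ[ (λ j → f (suc j)) ]           ≡⟨ Σ-single (λ j → f (suc j)) i (λ j j≢i → vanish (suc j) (j≢i ∘ suc-injective)) ⟩
  f (suc i)                        ∎
  where open ≡-Reasoning

Σ-split : ∀ m {n} (f : Fin (m +ℕ n) → ℤ) →
  Σ[ f ] ≡ Σ[ (λ i → f (i ↑ˡ n)) ] + Σ[ (λ j → f (m ↑ʳ j)) ]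
Σ-split zero    f = sym (ℤ.+-identityˡ _)
Σ-split (suc m) f = trans (cong (_+_ (f zero)) (Σ-split m (λ i → f (suc i)))) (sym (ℤ.+-assoc (f zero) _ _))

infix 4 _≈_
record _≈_ {m n} (M N : Mat m n) : Set where
  constructor entrywise
  field entry : ∀ a b → M a b ≡ N a b
open _≈_ public

≈-refl : ∀ {m n} {M : Mat m n} → M ≈ M
≈-refl = entrywise (λ a b → refl)

≈-sym : ∀ {m n} {M N : Mat m n} → M ≈ N → N ≈ M
≈-sym M≈N = entrywise (λ a b → sym (entry M≈N a b))

≈-trans : ∀ {m n} {M N P : Mat m n} → M ≈ N → N ≈ P → M ≈ P
≈-trans M≈N N≈P = entrywise (λ a b → trans (entry M≈N a b) (entry N≈P a b))

≈-setoid : ℕ → ℕ → Setoid _ _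
≈-setoid m n = record
  { Carrier = Mat m n
  ; _≈_ = _≈_
  ; isEquivalence = record { refl = ≈-refl ; sym = ≈-sym ; trans = ≈-trans }
  }

module ≈-Reasoning {m n} = SetoidReasoning (≈-setoid m n)

𝟙 : ∀ {n} → Mat n n
𝟙 a b = if ⌊ a ≟ b ⌋ then 1ℤ else 0ℤ

𝟘 : ∀ {m n} → Mat m n
𝟘 a b = 0ℤ

infixl 6 _⊕_
_⊕_ : ∀ {m n} → Mat m n → Mat m n → Mat m n
(M ⊕ N) a b = M a b + N a b

infixr 8 _·_
_·_ : ∀ {m n} → ℤ → Mat m n → Mat m n
(c · M) a b = c * M a b

⊗-cong : ∀ {m n p} {M M' : Mat m n} {N N' : Mat n p} → M ≈ M' → N ≈ N' → M ⊗ N ≈ M' ⊗ N'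
⊗-cong M≈M' N≈N' = entrywise (λ a c → Σ-cong (λ b → cong₂ _*_ (entry M≈M' a b) (entry N≈N' b c)))

⊗-congˡ : ∀ {m n p} {M M' : Mat m n} (N : Mat n p) → M ≈ M' → M ⊗ N ≈ M' ⊗ N
⊗-congˡ N M≈M' = ⊗-cong M≈M' (≈-refl {M = N})

⊗-congʳ : ∀ {m n p} (M : Mat m n) {N N' : Mat n p} → N ≈ N' → M ⊗ N ≈ M ⊗ N'
⊗-congʳ M = ⊗-cong (≈-refl {M = M})

⊕-cong : ∀ {m n} {M M' N N' : Mat m n} → M ≈ M' → N ≈ N' → M ⊕ N ≈ M' ⊕ N'
⊕-cong M≈M' N≈N' = entrywise (λ a b → cong₂ _+_ (entry M≈M' a b) (entry N≈N' a b))

·-congʳ : ∀ {m n} c {M N : Mat m n} → M ≈ N → c · M ≈ c · N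
·-congʳ c M≈N = entrywise (λ a b → cong (c *_) (entry M≈N a b))

·-congˡ : ∀ {m n} {c d} (M : Mat m n) → c ≡ d → c · M ≈ d · M
·-congˡ M refl = ≈-refl

·-assoc : ∀ {m n} c d (M : Mat m n) → c · d · M ≈ (c * d) · M
·-assoc c d M = entrywise (λ a b → sym (ℤ.*-assoc c d (M a b)))

⊗-assoc : ∀ {m n p q} (M : Mat m n) (N : Mat n p) (P : Mat p q) → (M ⊗ N) ⊗ P ≈ M ⊗ (N ⊗ P)
⊗-assoc M N P = entrywise λ a d → begin
  Σ[ (λ c → Σ[ (λ b → M a b * N b c) ] * P c d) ]    ≡⟨ Σ-cong (λ c → sym (Σ-*ʳ (P c d) (λ b → M a b * N b c))) ⟩
  Σ[ (λ c → Σ[ (λ b → M a b * N b c * P c d) ]) ]    ≡⟨ Σ-comm (λ c b → M a b * N b c * P c d) ⟩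
  Σ[ (λ b → Σ[ (λ c → M a b * N b c * P c d) ]) ]    ≡⟨ Σ-cong (λ b → Σ-cong (λ c → ℤ.*-assoc (M a b) (N b c) (P c d))) ⟩
  Σ[ (λ b → Σ[ (λ c → M a b * (N b c * P c d)) ]) ]  ≡⟨ Σ-cong (λ b → Σ-*ˡ (M a b) (λ c → N b c * P c d)) ⟩
  Σ[ (λ b → M a b * Σ[ (λ c → N b c * P c d) ]) ]    ∎
  where open ≡-Reasoning

𝟙-diag : ∀ {n} (a : Fin n) → 𝟙 a a ≡ 1ℤ
𝟙-diag a with a ≟ a
... | yes _  = refl
... | no a≢a = ⊥-elim (a≢a refl)

𝟙-offDiag : ∀ {n} {a b : Fin n} → a ≢ b → 𝟙 a b ≡ 0ℤ
𝟙-offDiag {a = a} {b} a≢b with a ≟ b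
... | yes a≡b = ⊥-elim (a≢b a≡b)
... | no _    = refl

⊗-identityˡ : ∀ {m n} (M : Mat m n) → 𝟙 ⊗ M ≈ M
⊗-identityˡ M = entrywise λ a b → trans
  (Σ-single (λ k → 𝟙 a k * M k b) a (λ k k≢a → cong (_* M k b) (𝟙-offDiag (λ a≡k → k≢a (sym a≡k)))))
  (trans (cong (_* M a b) (𝟙-diag a)) (ℤ.*-identityˡ (M a b)))

⊗-identityʳ : ∀ {m n} (M : Mat m n) → M ⊗ 𝟙 ≈ M
⊗-identityʳ M = entrywise λ a b → trans
  (Σ-single (λ k → M a k * 𝟙 k b) b (λ k k≢b → trans (cong (M a k *_) (𝟙-offDiag k≢b)) (ℤ.*-zeroʳ (M a k))))
  (trans (cong (M a b *_) (𝟙-diag b)) (ℤ.*-identityʳ (M a b)))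

⊗-absorbˡ : ∀ {m n p} {M : Mat m n} (N : Mat n p) → M ≈ 𝟘 → M ⊗ N ≈ 𝟘
⊗-absorbˡ N M≈𝟘 = entrywise λ a b →
  Σ-zero (λ k → trans (cong (_* N k b) (entry M≈𝟘 a k)) (ℤ.*-zeroˡ (N k b)))

⊗-absorbʳ : ∀ {m n p} (M : Mat m n) {N : Mat n p} → N ≈ 𝟘 → M ⊗ N ≈ 𝟘
⊗-absorbʳ M N≈𝟘 = entrywise λ a b →
  Σ-zero (λ k → trans (cong (M a k *_) (entry N≈𝟘 k b)) (ℤ.*-zeroʳ (M a k)))

⊕-vanishˡ : ∀ {m n} {M : Mat m n} (N : Mat m n) → M ≈ 𝟘 → M ⊕ N ≈ N
⊕-vanishˡ N M≈𝟘 = entrywise λ a b → trans (cong (_+ N a b) (entry M≈𝟘 a b)) (ℤ.+-identityˡ (N a b))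

⊕-vanishʳ : ∀ {m n} (M : Mat m n) {N : Mat m n} → N ≈ 𝟘 → M ⊕ N ≈ M
⊕-vanishʳ M N≈𝟘 = entrywise λ a b → trans (cong (_+_ (M a b)) (entry N≈𝟘 a b)) (ℤ.+-identityʳ (M a b))

·-⊗ : ∀ {m n p} c (M : Mat m n) (N : Mat n p) → (c · M) ⊗ N ≈ c · (M ⊗ N)
·-⊗ c M N = entrywise λ a b →
  trans (Σ-cong (λ k → ℤ.*-assoc c (M a k) (N k b))) (Σ-*ˡ c (λ k → M a k * N k b))

⊗-· : ∀ {m n p} c (M : Mat m n) (N : Mat n p) → M ⊗ (c · N) ≈ c · (M ⊗ N)
⊗-· c M N = entrywise λ a b →
  trans (Σ-cong (λ k → x∙yz≈y∙xz (M a k) c (N k b))) (Σ-*ˡ c (λ k → M a k * N k b))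

·-identityˡ : ∀ {m n} (M : Mat m n) → 1ℤ · M ≈ M
·-identityˡ M = entrywise (λ a b → ℤ.*-identityˡ (M a b))

·⊗· : ∀ {m n p} c d (M : Mat m n) (N : Mat n p) → (c · M) ⊗ (d · N) ≈ (c * d) · (M ⊗ N)
·⊗· c d M N = begin
  (c · M) ⊗ (d · N)   ≈⟨ ·-⊗ c M (d · N) ⟩
  c · (M ⊗ (d · N))   ≈⟨ ·-congʳ c (⊗-· d M N) ⟩
  c · d · (M ⊗ N)     ≈⟨ ·-assoc c d (M ⊗ N) ⟩
  (c * d) · (M ⊗ N)   ∎
  where open ≈-Reasoning

tr-cong : ∀ {n} {M N : Mat n n} → M ≈ N → tr M ≡ tr N
tr-cong M≈N = Σ-cong (λ a → entry M≈N a a)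

tr-· : ∀ {n} c (M : Mat n n) → tr (c · M) ≡ c * tr M
tr-· c M = Σ-*ˡ c (λ a → M a a)

·𝟙-injective : ∀ {n} {c d : ℤ} → Fin n → c · 𝟙 {n} ≈ d · 𝟙 → c ≡ d
·𝟙-injective {c = c} {d} a c𝟙≈d𝟙 = begin
  c           ≡⟨ ℤ.*-identityʳ c ⟨
  c * 1ℤ      ≡⟨ cong (c *_) (𝟙-diag a) ⟨
  c * 𝟙 a a   ≡⟨ entry c𝟙≈d𝟙 a a ⟩
  d * 𝟙 a a   ≡⟨ cong (d *_) (𝟙-diag a) ⟩
  d * 1ℤ      ≡⟨ ℤ.*-identityʳ d ⟩
  d           ∎
  where open ≡-Reasoning

⊗-reassoc : ∀ {n} (M N P Q : Mat n n) → (M ⊗ N) ⊗ (P ⊗ Q) ≈ M ⊗ ((N ⊗ P) ⊗ Q)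
⊗-reassoc M N P Q = ≈-trans (⊗-assoc M N (P ⊗ Q)) (⊗-congʳ M (≈-sym (⊗-assoc N P Q)))

⊕≈𝟘⇒≈-· : ∀ {m n} (M N : Mat m n) → M ⊕ N ≈ 𝟘 → M ≈ -1ℤ · N
⊕≈𝟘⇒≈-· M N M⊕N≈𝟘 = entrywise λ a b → begin
  M a b                     ≡⟨ ℤ.+-identityʳ (M a b) ⟨
  M a b + 0ℤ                ≡⟨ cong (_+_ (M a b)) (ℤ.+-inverseʳ (N a b)) ⟨
  M a b + (N a b - N a b)   ≡⟨ ℤ.+-assoc (M a b) (N a b) (- N a b) ⟨
  (M a b + N a b) - N a b   ≡⟨ cong (_- N a b) (entry M⊕N≈𝟘 a b) ⟩
  0ℤ - N a b                ≡⟨ ℤ.+-identityˡ (- N a b) ⟩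
  - N a b                   ≡⟨ ℤ.-1*i≡-i (N a b) ⟨
  -1ℤ * N a b               ∎
  where open ≡-Reasoning

tr-⊗-· : ∀ {n} {X Y X' Y' : Mat n n} c c' → X ≈ c · Y → X' ≈ c' · Y' →
  tr (X ⊗ X') ≡ (c * c') * tr (Y ⊗ Y')
tr-⊗-· {Y = Y} {Y' = Y'} c c' X≈cY X'≈c'Y' =
  trans (tr-cong (≈-trans (⊗-cong X≈cY X'≈c'Y') (·⊗· c c' Y Y'))) (tr-· (c * c') (Y ⊗ Y'))

-- Garden algebras

record IsGardenAlgebra {n} (L R : Fin 4 → Mat n n) : Set where
  field
    LR-diag     : ∀ I → L I ⊗ R I ≈ 𝟙
    RL-diag     : ∀ I → R I ⊗ L I ≈ 𝟙
    LR-anticomm : ∀ {I J} → I ≢ J → L I ⊗ R J ⊕ L J ⊗ R I ≈ 𝟘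
    RL-anticomm : ∀ {I J} → I ≢ J → R I ⊗ L J ⊕ R J ⊗ L I ≈ 𝟘

module GardenAlgebra {n} {L R : Fin 4 → Mat n n} (G : IsGardenAlgebra L R) where
  open IsGardenAlgebra G
  open ≈-Reasoning

  RL : Fin 4 → Fin 4 → Mat n n
  RL I J = R I ⊗ L J

  RL-inverse : ∀ I J → RL J I ⊗ RL I J ≈ 𝟙
  RL-inverse I J = begin
    (R J ⊗ L I) ⊗ (R I ⊗ L J)  ≈⟨ ⊗-reassoc (R J) (L I) (R I) (L J) ⟩
    R J ⊗ ((L I ⊗ R I) ⊗ L J)  ≈⟨ ⊗-congʳ (R J) (⊗-congˡ (L J) (LR-diag I)) ⟩
    R J ⊗ (𝟙 ⊗ L J)            ≈⟨ ⊗-congʳ (R J) (⊗-identityˡ (L J)) ⟩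
    R J ⊗ L J                  ≈⟨ RL-diag J ⟩
    𝟙                          ∎

  RL-antisym : ∀ {I J} → I ≢ J → RL J I ≈ -1ℤ · RL I J
  RL-antisym {I} {J} I≢J = ⊕≈𝟘⇒≈-· (RL J I) (RL I J) (RL-anticomm (≢-sym I≢J))

  RL-square : ∀ {I J} → I ≢ J → RL I J ⊗ RL I J ≈ -1ℤ · 𝟙
  RL-square {I} {J} I≢J = begin
    RL I J ⊗ RL I J             ≈⟨ ⊗-congˡ (RL I J) (RL-antisym (≢-sym I≢J)) ⟩
    (-1ℤ · RL J I) ⊗ RL I J     ≈⟨ ·-⊗ -1ℤ (RL J I) (RL I J) ⟩
    -1ℤ · (RL J I ⊗ RL I J)     ≈⟨ ·-congʳ -1ℤ (RL-inverse I J) ⟩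
    -1ℤ · 𝟙                     ∎

  RL-exchange : ∀ I J K M → K ≢ J → RL I K ⊗ RL J M ≈ -1ℤ · (RL I J ⊗ RL K M)
  RL-exchange I J K M K≢J = begin
    (R I ⊗ L K) ⊗ (R J ⊗ L M)             ≈⟨ ⊗-reassoc (R I) (L K) (R J) (L M) ⟩
    R I ⊗ ((L K ⊗ R J) ⊗ L M)             ≈⟨ ⊗-congʳ (R I) (⊗-congˡ (L M) (⊕≈𝟘⇒≈-· (L K ⊗ R J) (L J ⊗ R K) (LR-anticomm K≢J))) ⟩
    R I ⊗ ((-1ℤ · (L J ⊗ R K)) ⊗ L M)     ≈⟨ ⊗-congʳ (R I) (·-⊗ -1ℤ (L J ⊗ R K) (L M)) ⟩
    R I ⊗ (-1ℤ · ((L J ⊗ R K) ⊗ L M))     ≈⟨ ⊗-· -1ℤ (R I) ((L J ⊗ R K) ⊗ L M) ⟩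
    -1ℤ · (R I ⊗ ((L J ⊗ R K) ⊗ L M))     ≈⟨ ·-congʳ -1ℤ (⊗-reassoc (R I) (L J) (R K) (L M)) ⟨
    -1ℤ · ((R I ⊗ L J) ⊗ (R K ⊗ L M))     ∎

  RL-solve : ∀ {I J} {W : Mat n n} c → I ≢ J → RL I J ⊗ W ≈ c · 𝟙 → W ≈ (- c) · RL I J
  RL-solve {I} {J} {W} c I≢J RL⊗W≈c = begin
    W                          ≈⟨ ⊗-identityˡ W ⟨
    𝟙 ⊗ W                      ≈⟨ ⊗-congˡ W (RL-inverse I J) ⟨
    (RL J I ⊗ RL I J) ⊗ W      ≈⟨ ⊗-assoc (RL J I) (RL I J) W ⟩
    RL J I ⊗ (RL I J ⊗ W)      ≈⟨ ⊗-congʳ (RL J I) RL⊗W≈c ⟩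
    RL J I ⊗ (c · 𝟙)           ≈⟨ ⊗-· c (RL J I) 𝟙 ⟩
    c · (RL J I ⊗ 𝟙)           ≈⟨ ·-congʳ c (⊗-identityʳ (RL J I)) ⟩
    c · RL J I                 ≈⟨ ·-congʳ c (RL-antisym I≢J) ⟩
    c · -1ℤ · RL I J           ≈⟨ ·-assoc c -1ℤ (RL I J) ⟩
    (c * -1ℤ) · RL I J         ≈⟨ ·-congˡ (RL I J) (trans (ℤ.*-comm c -1ℤ) (ℤ.-1*i≡-i c)) ⟩
    (- c) · RL I J             ∎

  module Chirality (χ : ℤ) (chiral : RL c1 c2 ⊗ RL c3 c4 ≈ (- χ) · 𝟙) where

    RL₃₄≈χ·RL₁₂ : RL c3 c4 ≈ χ · RL c1 c2
    RL₃₄≈χ·RL₁₂ = ≈-trans (RL-solve (- χ) (λ ()) chiral) (·-congˡ (RL c1 c2) (ℤ.neg-involutive χ))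

    RL₂₄≈-χ·RL₁₃ : RL c2 c4 ≈ (- χ) · RL c1 c3
    RL₂₄≈-χ·RL₁₃ = RL-solve χ (λ ()) (begin
      RL c1 c3 ⊗ RL c2 c4          ≈⟨ RL-exchange c1 c2 c3 c4 (λ ()) ⟩
      -1ℤ · (RL c1 c2 ⊗ RL c3 c4)  ≈⟨ ·-congʳ -1ℤ chiral ⟩
      -1ℤ · (- χ) · 𝟙              ≈⟨ ·-assoc -1ℤ (- χ) 𝟙 ⟩
      (-1ℤ * - χ) · 𝟙              ≈⟨ ·-congˡ 𝟙 (trans (ℤ.-1*i≡-i (- χ)) (ℤ.neg-involutive χ)) ⟩
      χ · 𝟙                        ∎)

    RL₂₃≈χ·RL₁₄ : RL c2 c3 ≈ χ · RL c1 c4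
    RL₂₃≈χ·RL₁₄ = ≈-trans (RL-solve (- χ) (λ ()) (begin
      RL c1 c4 ⊗ RL c2 c3                  ≈⟨ RL-exchange c1 c2 c4 c3 (λ ()) ⟩
      -1ℤ · (RL c1 c2 ⊗ RL c4 c3)          ≈⟨ ·-congʳ -1ℤ (⊗-congʳ (RL c1 c2) (RL-antisym (λ ()))) ⟩
      -1ℤ · (RL c1 c2 ⊗ (-1ℤ · RL c3 c4))  ≈⟨ ·-congʳ -1ℤ (⊗-· -1ℤ (RL c1 c2) (RL c3 c4)) ⟩
      -1ℤ · -1ℤ · (RL c1 c2 ⊗ RL c3 c4)    ≈⟨ ·-assoc -1ℤ -1ℤ (RL c1 c2 ⊗ RL c3 c4) ⟩
      1ℤ · (RL c1 c2 ⊗ RL c3 c4)           ≈⟨ ·-identityˡ (RL c1 c2 ⊗ RL c3 c4) ⟩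
      RL c1 c2 ⊗ RL c3 c4                  ≈⟨ chiral ⟩
      (- χ) · 𝟙                            ∎))
      (·-congˡ (RL c1 c4) (ℤ.neg-involutive χ))

    χ*χ≡1 : Fin n → χ * χ ≡ 1ℤ
    χ*χ≡1 a = sym (ℤ.*-cancelʳ-≡ 1ℤ (χ * χ) -1ℤ (·𝟙-injective a (begin
      -1ℤ · 𝟙                          ≈⟨ RL-square (λ ()) ⟨
      RL c3 c4 ⊗ RL c3 c4              ≈⟨ ⊗-cong RL₃₄≈χ·RL₁₂ RL₃₄≈χ·RL₁₂ ⟩
      (χ · RL c1 c2) ⊗ (χ · RL c1 c2)  ≈⟨ ·⊗· χ χ (RL c1 c2) (RL c1 c2) ⟩
      (χ * χ) · (RL c1 c2 ⊗ RL c1 c2)  ≈⟨ ·-congʳ (χ * χ) (RL-square (λ ())) ⟩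
      (χ * χ) · -1ℤ · 𝟙                ≈⟨ ·-assoc (χ * χ) -1ℤ 𝟙 ⟩
      (χ * χ * -1ℤ) · 𝟙                ∎)))

-- The garden algebra of a valise

sign : Bool → ℤ
sign b = if b then -1ℤ else 1ℤ

sign-square : ∀ b → sign b * sign b ≡ 1ℤ
sign-square true  = refl
sign-square false = refl

sign-xor : ∀ a b → sign (a xor b) ≡ sign a * sign b
sign-xor true  true  = refl
sign-xor true  false = refl
sign-xor false true  = refl
sign-xor false false = refl

sign-cancel : ∀ a b → a xor b ≡ true → sign a + sign b ≡ 0ℤ
sign-cancel true  false _ = refl
sign-cancel false true  _ = refl

sign-cycle : ∀ a b c d → (a xor b xor c xor d) ≡ true → sign a * sign b + sign d * sign c ≡ 0ℤ
sign-cycle a b c d odd = begin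
  sign a * sign b + sign d * sign c  ≡⟨ cong₂ _+_ (sign-xor a b) (trans (sign-xor c d) (ℤ.*-comm (sign c) (sign d))) ⟨
  sign (a xor b) + sign (c xor d)    ≡⟨ sign-cancel (a xor b) (c xor d) (trans (xor-assoc a b (c xor d)) odd) ⟩
  0ℤ                                 ∎
  where open ≡-Reasoning

xor-exchange : ∀ a b c d → (c xor b xor a xor d) ≡ (a xor b xor c xor d)
xor-exchange true  true  true  d = refl
xor-exchange true  true  false d = refl
xor-exchange true  false true  d = refl
xor-exchange true  false false d = refl
xor-exchange false true  true  d = refl
xor-exchange false true  false d = refl
xor-exchange false false true  d = refl
xor-exchange false false false d = refl

partner : Valise41 → Fin 4 → Fin 4 → Fin 4
partner A i I = proj₁ (colorB A i I)

partner-color : ∀ A i I → color A i (partner A i I) ≡ I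
partner-color A i I = proj₁ (proj₂ (colorB A i I))

colorB-unique : ∀ A {i j j' I} → color A i j ≡ I → color A i j' ≡ I → j ≡ j'
colorB-unique A {i} {I = I} ij ij' = trans (sym (unique ij)) (unique ij')
  where unique = proj₂ (proj₂ (colorB A i I))

colorF-unique : ∀ A {i i' j I} → color A i j ≡ I → color A i' j ≡ I → i ≡ i'
colorF-unique A {j = j} {I} ij i'j = trans (sym (unique ij)) (unique i'j)
  where unique = proj₂ (proj₂ (colorF A j I))

cycle-closes : ∀ A {I J i j k l} → I ≢ J →
  color A i j ≡ I → color A i l ≡ J → color A k j ≡ J → color A k l ≡ I
cycle-closes A {I} {J} {i} {j} {k} I≢J ij il kj =
  subst (λ m → color A k m ≡ I) (colorB-unique A im il) km
  where
  km = partner-color A k I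
  im = fourCycles A I J I≢J i j k (partner A k I) ij kj km

L-colored : ∀ A {I i j} → color A i j ≡ I → L A I i j ≡ sign (dashed A i j)
L-colored A {I} {i} {j} ij with color A i j ≟ I
... | yes _  = refl
... | no ¬ij = ⊥-elim (¬ij ij)

L-uncolored : ∀ A {I i j} → color A i j ≢ I → L A I i j ≡ 0ℤ
L-uncolored A {I} {i} {j} ¬ij with color A i j ≟ I
... | yes ij = ⊥-elim (¬ij ij)
... | no _   = refl

L⊗R-entry : ∀ A {I J i j} k → color A i j ≡ I →
  (L A I ⊗ R A J) i k ≡ sign (dashed A i j) * L A J k j
L⊗R-entry A {I} {J} {i} {j} k ij =
  trans (Σ-single (λ j' → L A I i j' * L A J k j') j off-j) (cong (_* L A J k j) (L-colored A ij))
  where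
  off-j : ∀ j' → j' ≢ j → L A I i j' * L A J k j' ≡ 0ℤ
  off-j j' j'≢j = trans (cong (_* L A J k j') (L-uncolored A (λ ij' → j'≢j (colorB-unique A ij' ij))))
                        (ℤ.*-zeroˡ (L A J k j'))

L⊗R-diag : ∀ A I → L A I ⊗ R A I ≈ 𝟙
L⊗R-diag A I = entrywise λ i k →
  trans (L⊗R-entry A k (partner-color A i I)) (diag (partner-color A i I) (i ≟ k))
  where
  diag : ∀ {i j k} → color A i j ≡ I → Dec (i ≡ k) → sign (dashed A i j) * L A I k j ≡ 𝟙 i k
  diag {i} {j} ij (yes refl) = begin
    sign (dashed A i j) * L A I i j              ≡⟨ cong (sign (dashed A i j) *_) (L-colored A ij) ⟩
    sign (dashed A i j) * sign (dashed A i j)    ≡⟨ sign-square (dashed A i j) ⟩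
    1ℤ                                           ≡⟨ 𝟙-diag i ⟨
    𝟙 i i                                        ∎
    where open ≡-Reasoning
  diag {i} {j} {k} ij (no i≢k) = begin
    sign (dashed A i j) * L A I k j    ≡⟨ cong (sign (dashed A i j) *_) (L-uncolored A (λ kj → i≢k (colorF-unique A ij kj))) ⟩
    sign (dashed A i j) * 0ℤ           ≡⟨ ℤ.*-zeroʳ (sign (dashed A i j)) ⟩
    0ℤ                                 ≡⟨ 𝟙-offDiag i≢k ⟨
    𝟙 i k                              ∎
    where open ≡-Reasoning

L⊗R-anticomm : ∀ A {I J} → I ≢ J → L A I ⊗ R A J ⊕ L A J ⊗ R A I ≈ 𝟘
L⊗R-anticomm A {I} {J} I≢J = entrywise λ i k →
  trans (cong₂ _+_ (L⊗R-entry A k (partner-color A i I)) (L⊗R-entry A k (partner-color A i J)))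
        (cancel (partner-color A i I) (partner-color A i J) (color A k (partner A i I) ≟ J))
  where
  -- The edges k–j of colour J and k–l of colour I are both present (closing a two-coloured
  -- 4-cycle, whose odd dashing makes the terms cancel) or both absent.
  cancel : ∀ {i j k l} → color A i j ≡ I → color A i l ≡ J → Dec (color A k j ≡ J) →
    sign (dashed A i j) * L A J k j + sign (dashed A i l) * L A I k l ≡ 0ℤ
  cancel {i} {j} {k} {l} ij il (yes kj) = begin
    sign (dashed A i j) * L A J k j + sign (dashed A i l) * L A I k l
      ≡⟨ cong₂ _+_ (cong (sign (dashed A i j) *_) (L-colored A kj)) (cong (sign (dashed A i l) *_) (L-colored A kl)) ⟩
    sign (dashed A i j) * sign (dashed A k j) + sign (dashed A i l) * sign (dashed A k l)
      ≡⟨ sign-cycle (dashed A i j) (dashed A k j) (dashed A k l) (dashed A i l) (oddDashing A I J I≢J i j k l ij kj kl il) ⟩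
    0ℤ ∎
    where
    open ≡-Reasoning
    kl = cycle-closes A I≢J ij il kj
  cancel {i} {j} {k} {l} ij il (no ¬kj) = cong₂ _+_
    (trans (cong (sign (dashed A i j) *_) (L-uncolored A ¬kj)) (ℤ.*-zeroʳ (sign (dashed A i j))))
    (trans (cong (sign (dashed A i l) *_) (L-uncolored A ¬kl)) (ℤ.*-zeroʳ (sign (dashed A i l))))
    where
    ¬kl : color A k l ≢ I
    ¬kl kl = ¬kj (cycle-closes A (≢-sym I≢J) il ij kl)

-- Interchanging bosons and fermions turns L into R, so the relations for R ⊗ L are
-- those for L ⊗ R in the dual adinkra.
dual : Valise41 → Valise41
dual A = record
  { color      = λ i j → color A j i
  ; dashed     = λ i j → dashed A j i
  ; colorB     = colorF A
  ; colorF     = colorB A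
  ; fourCycles = λ I J I≢J i j k l ji jk lk → fourCycles A I J I≢J l k j i lk jk ji
  ; oddDashing = λ I J I≢J i j k l ji jk lk li →
      trans (xor-exchange (dashed A l k) (dashed A j k) (dashed A j i) (dashed A l i))
            (oddDashing A I J I≢J l k j i lk jk ji li)
  }

L-dual : ∀ A I i j → L (dual A) I i j ≡ R A I i j
L-dual A I i j with color A j i ≟ I
... | yes _ = refl
... | no _  = refl

R⊗L≈dual-L⊗R : ∀ A I J → R A I ⊗ L A J ≈ L (dual A) I ⊗ R (dual A) J
R⊗L≈dual-L⊗R A I J = entrywise λ a b → Σ-cong (λ k → sym (cong₂ _*_ (L-dual A I a k) (L-dual A J b k)))

R⊗L-diag : ∀ A I → R A I ⊗ L A I ≈ 𝟙
R⊗L-diag A I = ≈-trans (R⊗L≈dual-L⊗R A I I) (L⊗R-diag (dual A) I)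

R⊗L-anticomm : ∀ A {I J} → I ≢ J → R A I ⊗ L A J ⊕ R A J ⊗ L A I ≈ 𝟘
R⊗L-anticomm A {I} {J} I≢J =
  ≈-trans (⊕-cong (R⊗L≈dual-L⊗R A I J) (R⊗L≈dual-L⊗R A J I)) (L⊗R-anticomm (dual A) I≢J)

valise-isGardenAlgebra : ∀ A → IsGardenAlgebra (L A) (R A)
valise-isGardenAlgebra A = record
  { LR-diag     = L⊗R-diag A
  ; RL-diag     = R⊗L-diag A
  ; LR-anticomm = L⊗R-anticomm A
  ; RL-anticomm = R⊗L-anticomm A
  }

-- Fermionic blocks

∣FB ∣BF ∣B : Mat 8 8 → Mat 4 4
∣FB M a b = M (a ↑ˡ 4) (4 ↑ʳ b)
∣BF M a b = M (4 ↑ʳ a) (b ↑ˡ 4)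
∣B  M a b = M (4 ↑ʳ a) (4 ↑ʳ b)

∣F-⊗ : ∀ (M N : Mat 8 8) → ∣F (M ⊗ N) ≈ ∣F M ⊗ ∣F N ⊕ ∣FB M ⊗ ∣BF N
∣F-⊗ M N = entrywise λ a b → Σ-split 4 (λ k → M (a ↑ˡ 4) k * N k (b ↑ˡ 4))

∣FB-⊗ : ∀ (M N : Mat 8 8) → ∣FB (M ⊗ N) ≈ ∣F M ⊗ ∣FB N ⊕ ∣FB M ⊗ ∣B N
∣FB-⊗ M N = entrywise λ a b → Σ-split 4 (λ k → M (a ↑ˡ 4) k * N k (4 ↑ʳ b))

∣F-⊗-odd : ∀ (M N : Mat 8 8) → ∣F M ≈ 𝟘 → ∣F (M ⊗ N) ≈ ∣FB M ⊗ ∣BF N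
∣F-⊗-odd M N F≈𝟘 = ≈-trans (∣F-⊗ M N) (⊕-vanishˡ _ (⊗-absorbˡ (∣F N) F≈𝟘))

∣F-⊗-even : ∀ (M N : Mat 8 8) → ∣FB M ≈ 𝟘 → ∣F (M ⊗ N) ≈ ∣F M ⊗ ∣F N
∣F-⊗-even M N FB≈𝟘 = ≈-trans (∣F-⊗ M N) (⊕-vanishʳ _ (⊗-absorbˡ (∣BF N) FB≈𝟘))

∣FB-⊗-odd : ∀ (M N : Mat 8 8) → ∣F M ≈ 𝟘 → ∣FB (M ⊗ N) ≈ ∣FB M ⊗ ∣B N
∣FB-⊗-odd M N F≈𝟘 = ≈-trans (∣FB-⊗ M N) (⊕-vanishˡ _ (⊗-absorbˡ (∣FB N) F≈𝟘))

∣FB-⊗-even : ∀ (M N : Mat 8 8) → ∣FB M ≈ 𝟘 → ∣FB (M ⊗ N) ≈ ∣F M ⊗ ∣FB N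
∣FB-⊗-even M N FB≈𝟘 = ≈-trans (∣FB-⊗ M N) (⊕-vanishʳ _ (⊗-absorbˡ (∣B N) FB≈𝟘))

∣F-φ : ∀ A I → ∣F (φ A I) ≈ 𝟘
∣F-φ A I = entrywise φ-FF
  where
  φ-FF : ∀ a b → φ A I (a ↑ˡ 4) (b ↑ˡ 4) ≡ 0ℤ
  φ-FF a b rewrite splitAt-↑ˡ 4 a 4 | splitAt-↑ˡ 4 b 4 = refl

∣FB-φ : ∀ A I → ∣FB (φ A I) ≈ R A I
∣FB-φ A I = entrywise φ-FB
  where
  φ-FB : ∀ a b → φ A I (a ↑ˡ 4) (4 ↑ʳ b) ≡ R A I a b
  φ-FB a b rewrite splitAt-↑ˡ 4 a 4 | splitAt-↑ʳ 4 4 b = refl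

∣BF-φ : ∀ A I → ∣BF (φ A I) ≈ L A I
∣BF-φ A I = entrywise φ-BF
  where
  φ-BF : ∀ a b → φ A I (4 ↑ʳ a) (b ↑ˡ 4) ≡ L A I a b
  φ-BF a b rewrite splitAt-↑ʳ 4 4 a | splitAt-↑ˡ 4 b 4 = refl

∣B-φ : ∀ A I → ∣B (φ A I) ≈ 𝟘
∣B-φ A I = entrywise φ-BB
  where
  φ-BB : ∀ a b → φ A I (4 ↑ʳ a) (4 ↑ʳ b) ≡ 0ℤ
  φ-BB a b rewrite splitAt-↑ʳ 4 4 a | splitAt-↑ʳ 4 4 b = refl

∣F-diagBlock : ∀ χ → ∣F (diagBlock χ) ≈ (- χ) · 𝟙
∣F-diagBlock χ = entrywise diag-FF
  where
  diag-FF : ∀ a b → diagBlock χ (a ↑ˡ 4) (b ↑ˡ 4) ≡ (- χ) * 𝟙 a b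
  diag-FF a b rewrite splitAt-↑ˡ 4 a 4 | splitAt-↑ˡ 4 b 4 with a ≟ b
  ... | yes _ = sym (ℤ.*-identityʳ (- χ))
  ... | no _  = sym (ℤ.*-zeroʳ (- χ))

∣F-φ₂ : ∀ A I J → ∣F (φ₂ A I J) ≈ R A I ⊗ L A J
∣F-φ₂ A I J = ≈-trans (∣F-⊗-odd (φ A I) (φ A J) (∣F-φ A I)) (⊗-cong (∣FB-φ A I) (∣BF-φ A J))

∣FB-φ₂ : ∀ A I J → ∣FB (φ₂ A I J) ≈ 𝟘
∣FB-φ₂ A I J = ≈-trans (∣FB-⊗-odd (φ A I) (φ A J) (∣F-φ A I)) (⊗-absorbʳ (∣FB (φ A I)) (∣B-φ A J))

g≈R⊗L⊗R⊗L : ∀ A A' I J → g A A' I J ≈ (R A I ⊗ L A J) ⊗ (R A' I ⊗ L A' J)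
g≈R⊗L⊗R⊗L A A' I J = ≈-trans (∣F-⊗-even (φ₂ A I J) (φ₂ A' I J) (∣FB-φ₂ A I J)) (⊗-cong (∣F-φ₂ A I J) (∣F-φ₂ A' I J))

chirality-R⊗L : ∀ A χ → IsChirality A χ → (R A c1 ⊗ L A c2) ⊗ (R A c3 ⊗ L A c4) ≈ (- χ) · 𝟙
chirality-R⊗L A χ chiral = begin
  (R A c1 ⊗ L A c2) ⊗ (R A c3 ⊗ L A c4)  ≈⟨ ⊗-assoc (R A c1 ⊗ L A c2) (R A c3) (L A c4) ⟨
  ((R A c1 ⊗ L A c2) ⊗ R A c3) ⊗ L A c4  ≈⟨ ⊗-cong ∣FB-φ₁₂₃ (∣BF-φ A c4) ⟨
  ∣FB φ₁₂₃ ⊗ ∣BF (φ A c4)                 ≈⟨ ∣F-⊗-odd φ₁₂₃ (φ A c4) ∣F-φ₁₂₃ ⟨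
  ∣F (φ₁₂₃ ⊗ φ A c4)                      ≈⟨ entrywise (λ a b → chiral (a ↑ˡ 4) (b ↑ˡ 4)) ⟩
  ∣F (diagBlock χ)                        ≈⟨ ∣F-diagBlock χ ⟩
  (- χ) · 𝟙                               ∎
  where
  open ≈-Reasoning
  φ₁₂₃ = φ₂ A c1 c2 ⊗ φ A c3
  ∣F-φ₁₂₃ : ∣F φ₁₂₃ ≈ 𝟘
  ∣F-φ₁₂₃ = ≈-trans (∣F-⊗-even (φ₂ A c1 c2) (φ A c3) (∣FB-φ₂ A c1 c2)) (⊗-absorbʳ (∣F (φ₂ A c1 c2)) (∣F-φ A c3))
  ∣FB-φ₁₂₃ : ∣FB φ₁₂₃ ≈ (R A c1 ⊗ L A c2) ⊗ R A c3
  ∣FB-φ₁₂₃ = ≈-trans (∣FB-⊗-even (φ₂ A c1 c2) (φ A c3) (∣FB-φ₂ A c1 c2)) (⊗-cong (∣F-φ₂ A c1 c2) (∣FB-φ A c3))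

offDiag-sum : ∀ (t : Fin 4 → Fin 4 → ℤ) → (∀ I J → I ≢ J → t J I ≡ t I J) →
  Σ[ (λ I → Σ[ (λ J → if ⌊ I ≟ J ⌋ then 0ℤ else t I J) ]) ]
    ≡ (t c1 c2 + t c1 c3 + t c1 c4 + (t c3 c4 + t c2 c4 + t c2 c3))
    + (t c1 c2 + t c1 c3 + t c1 c4 + (t c3 c4 + t c2 c4 + t c2 c3))
offDiag-sum t t-sym
  rewrite t-sym c1 c2 (λ ()) | t-sym c1 c3 (λ ()) | t-sym c1 c4 (λ ())
        | t-sym c2 c3 (λ ()) | t-sym c2 c4 (λ ()) | t-sym c3 c4 (λ ())
  = pairing (t c1 c2) (t c1 c3) (t c1 c4) (t c2 c3) (t c2 c4) (t c3 c4)
  where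
  -- The left side is the double sum unfolded, with 0ℤ on the diagonal.
  pairing : ∀ t₁₂ t₁₃ t₁₄ t₂₃ t₂₄ t₃₄ →
    (0ℤ + (t₁₂ + (t₁₃ + (t₁₄ + 0ℤ)))) + ((t₁₂ + (0ℤ + (t₂₃ + (t₂₄ + 0ℤ))))
      + ((t₁₃ + (t₂₃ + (0ℤ + (t₃₄ + 0ℤ)))) + ((t₁₄ + (t₂₄ + (t₃₄ + (0ℤ + 0ℤ)))) + 0ℤ)))
    ≡ (t₁₂ + t₁₃ + t₁₄ + (t₃₄ + t₂₄ + t₂₃)) + (t₁₂ + t₁₃ + t₁₄ + (t₃₄ + t₂₄ + t₂₃))
  pairing = solve-∀

chirality-square : ∀ A χ → IsChirality A χ → χ * χ ≡ 1ℤ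
chirality-square A χ chiral =
  GardenAlgebra.Chirality.χ*χ≡1 (valise-isGardenAlgebra A) χ (chirality-R⊗L A χ chiral) zero

module _ (A A' : Valise41) where
  private
    module 𝔸  = GardenAlgebra (valise-isGardenAlgebra A)
    module 𝔸' = GardenAlgebra (valise-isGardenAlgebra A')

  τ : ℤ
  τ = tr (g A A' c1 c2) + tr (g A A' c1 c3) + tr (g A A' c1 c4)

  tr-g-rescale : ∀ I J K M c c' → 𝔸.RL K M ≈ c · 𝔸.RL I J → 𝔸'.RL K M ≈ c' · 𝔸'.RL I J →
    tr (g A A' K M) ≡ (c * c') * tr (g A A' I J)
  tr-g-rescale I J K M c c' RL≈ RL'≈ = begin
    tr (g A A' K M)                       ≡⟨ tr-cong (g≈R⊗L⊗R⊗L A A' K M) ⟩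
    tr (𝔸.RL K M ⊗ 𝔸'.RL K M)             ≡⟨ tr-⊗-· c c' RL≈ RL'≈ ⟩
    (c * c') * tr (𝔸.RL I J ⊗ 𝔸'.RL I J)  ≡⟨ cong ((c * c') *_) (tr-cong (g≈R⊗L⊗R⊗L A A' I J)) ⟨
    (c * c') * tr (g A A' I J)            ∎
    where open ≡-Reasoning

  tr-g-sym : ∀ I J → I ≢ J → tr (g A A' J I) ≡ tr (g A A' I J)
  tr-g-sym I J I≢J =
    trans (tr-g-rescale I J J I -1ℤ -1ℤ (𝔸.RL-antisym I≢J) (𝔸'.RL-antisym I≢J))
          (ℤ.*-identityˡ (tr (g A A' I J)))

  sumOffDiag≡ : ∀ χ χ' → IsChirality A χ → IsChirality A' χ' →
    sumOffDiag A A' ≡ τ * (1ℤ + χ * χ') + τ * (1ℤ + χ * χ')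
  sumOffDiag≡ χ χ' chiral chiral' = begin
    sumOffDiag A A'                        ≡⟨ offDiag-sum t tr-g-sym ⟩
    P + P                                  ≡⟨ cong (λ x → x + x) P≡S ⟩
    S + S                                  ≡⟨ cong (λ x → x + x) (collect χ χ' (t c1 c2) (t c1 c3) (t c1 c4)) ⟩
    τ * (1ℤ + χ * χ') + τ * (1ℤ + χ * χ')  ∎
    where
    open ≡-Reasoning
    module χ  = 𝔸.Chirality χ (chirality-R⊗L A χ chiral)
    module χ' = 𝔸'.Chirality χ' (chirality-R⊗L A' χ' chiral')
    t : Fin 4 → Fin 4 → ℤ
    t I J = tr (g A A' I J)
    t₃₄ = tr-g-rescale c1 c2 c3 c4 χ χ' χ.RL₃₄≈χ·RL₁₂ χ'.RL₃₄≈χ·RL₁₂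
    t₂₄ = tr-g-rescale c1 c3 c2 c4 (- χ) (- χ') χ.RL₂₄≈-χ·RL₁₃ χ'.RL₂₄≈-χ·RL₁₃
    t₂₃ = tr-g-rescale c1 c4 c2 c3 χ χ' χ.RL₂₃≈χ·RL₁₄ χ'.RL₂₃≈χ·RL₁₄
    P = t c1 c2 + t c1 c3 + t c1 c4 + (t c3 c4 + t c2 c4 + t c2 c3)
    S = t c1 c2 + t c1 c3 + t c1 c4 + ((χ * χ') * t c1 c2 + (- χ * - χ') * t c1 c3 + (χ * χ') * t c1 c4)
    P≡S : P ≡ S
    P≡S = cong (_+_ (t c1 c2 + t c1 c3 + t c1 c4)) (cong₂ _+_ (cong₂ _+_ t₃₄ t₂₄) t₂₃)
    collect : ∀ x y a b c → a + b + c + ((x * y) * a + (- x * - y) * b + (x * y) * c) ≡ (a + b + c) * (1ℤ + x * y)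
    collect = solve-∀

unit-square : ∀ χ → χ * χ ≡ 1ℤ → χ ≡ 1ℤ ⊎ χ ≡ -1ℤ
unit-square (+ 0)               ()
unit-square (+ 1)               _ = inj₁ refl
unit-square (+ (suc (suc n)))   ()
unit-square -[1+ 0 ]            _ = inj₂ refl
unit-square -[1+ suc n ]        ()

distinct-units-product : ∀ {χ χ'} → χ * χ ≡ 1ℤ → χ' * χ' ≡ 1ℤ → χ ≢ χ' → χ * χ' ≡ -1ℤ
distinct-units-product {χ} {χ'} χ² χ'² χ≢χ' with unit-square χ χ² | unit-square χ' χ'²
... | inj₁ refl | inj₁ refl = ⊥-elim (χ≢χ' refl)
... | inj₁ refl | inj₂ refl = refl
... | inj₂ refl | inj₁ refl = refl
... | inj₂ refl | inj₂ refl = ⊥-elim (χ≢χ' refl)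

-[Y+Y]/48≡-1/24*Y : ∀ Y → -ℚ ((Y + Y) ÷ 48) ≡ (-ℚ (1ℤ ÷ 24)) *ℚ (Y ÷ 1)
-[Y+Y]/48≡-1/24*Y Y = ℚ.toℚᵘ-injective (begin
  toℚᵘ (-ℚ ((Y + Y) ÷ 48))                  ≈⟨ ℚ.toℚᵘ-homo‿- ((Y + Y) ÷ 48) ⟩
  -ᵘ toℚᵘ ((Y + Y) ÷ 48)                  ≈⟨ ℚᵘ.-‿cong (ℚ.toℚᵘ-fromℚᵘ (mkℚᵘ (Y + Y) 47)) ⟩
  -ᵘ mkℚᵘ (Y + Y) 47                      ≈⟨ *≡* (cross-multiply Y) ⟩
  mkℚᵘ -1ℤ 23 *ᵘ mkℚᵘ Y 0                 ≈⟨ ℚᵘ.*-congˡ {mkℚᵘ -1ℤ 23} (ℚ.toℚᵘ-fromℚᵘ (mkℚᵘ Y 0)) ⟨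
  toℚᵘ (-ℚ (1ℤ ÷ 24)) *ᵘ toℚᵘ (Y ÷ 1)     ≈⟨ ℚ.toℚᵘ-homo-* (-ℚ (1ℤ ÷ 24)) (Y ÷ 1) ⟨
  toℚᵘ ((-ℚ (1ℤ ÷ 24)) *ℚ (Y ÷ 1))          ∎)
  where
  open ℚᵘ.≃-Reasoning
  cross-multiply : ∀ Y → (- (Y + Y)) * + 24 ≡ (-1ℤ * Y) * + 48
  cross-multiply = solve-∀

corollary5p2 : ∀ (A A' : Valise41) (χ χ' : ℤ) → IsChirality A χ → IsChirality A' χ' →
    (OG A A' ≡ (-ℚ (1ℤ ÷ 24)) *ℚ (((tr (g A A' c1 c2) + tr (g A A' c1 c3) + tr (g A A' c1 c4)) * (1ℤ + χ * χ')) ÷ 1))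
    × (χ ≢ χ' → OG A A' ≡ 0ℚ)
corollary5p2 A A' χ χ' chiral chiral' = OG≡ , OG≡0
  where
  open ≡-Reasoning
  Y = τ A A' * (1ℤ + χ * χ')
  OG≡ : OG A A' ≡ (-ℚ (1ℤ ÷ 24)) *ℚ (Y ÷ 1)
  OG≡ = begin
    -ℚ (sumOffDiag A A' ÷ 48)   ≡⟨ cong (λ s → -ℚ (s ÷ 48)) (sumOffDiag≡ A A' χ χ' chiral chiral') ⟩
    -ℚ ((Y + Y) ÷ 48)           ≡⟨ -[Y+Y]/48≡-1/24*Y Y ⟩
    (-ℚ (1ℤ ÷ 24)) *ℚ (Y ÷ 1)   ∎
  OG≡0 : χ ≢ χ' → OG A A' ≡ 0ℚ
  OG≡0 χ≢χ' = begin
    OG A A'                                            ≡⟨ OG≡ ⟩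
    (-ℚ (1ℤ ÷ 24)) *ℚ ((τ A A' * (1ℤ + χ * χ')) ÷ 1)  ≡⟨ cong (λ x → (-ℚ (1ℤ ÷ 24)) *ℚ ((τ A A' * (1ℤ + x)) ÷ 1)) χχ'≡-1 ⟩
    (-ℚ (1ℤ ÷ 24)) *ℚ ((τ A A' * 0ℤ) ÷ 1)             ≡⟨ cong (λ x → (-ℚ (1ℤ ÷ 24)) *ℚ (x ÷ 1)) (ℤ.*-zeroʳ (τ A A')) ⟩
    0ℚ                                                 ∎
    where
    χχ'≡-1 = distinct-units-product (chirality-square A χ chiral) (chirality-square A' χ' chiral') χ≢χ'
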